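{- Huang and Wong's recurrence for optimal generalized binary split trees (their "Lemma 4") and the algorithm based on it are incorrect. Specifically, take the $n=31$ keys, in increasing order, $a1<a2<a3<b0<b4<c0<d0<d1<e0<n0<n1<p0<p2<q0<q1<r0<s0<s1<t0<t2<u0<u1<v0<v3<w0<w1<x0<x2<y0<y1<z0$, with frequencies (weights) $20,20,20,10,20,5,10,22,10,10,20,10,20,10,20,10,10,20,10,20,10,20,10,20,10,20,10,20,10,20,10$ respectively. On this instance the algorithm described below outputs the value $p[0,n,0]=1763$, whereas there exists a generalized binary split tree for this instance of cost $1762$.
   Context: A generalized binary split tree (GBST) for keys $K_1<\dots<K_n$ (only successful queries, i.e., every query is a key) is a rooted binary tree in which each node $N$ has an equality key $e_N$ and a split key $s_N$. A search for $v$ starts at the root; at node $N$, if $v=e_N$ it halts, otherwise it recurses to the left subtree if $v<s_N$ and to the right subtree if $v\ge s_N$. Every key must be found. With key weights $\beta_i$, the cost of the tree is $\sum_i\beta_i\cdot(\text{number of nodes visited by the search for }K_i)$. Huang and Wong's algorithm computes, for $0\le i\le j\le n$ and $0\le d\le j-i$ ("legal" triples), a triple $(p[i,j,d],w[i,j,d],D[i,j,d])$ with $D[i,j,d]$ a set of key indices, as follows. If $d=j-i$: $(0,0,\{i+1,\dots,j\})$. Otherwise, for each $k\in\{i+1,\dots,j\}$ and $m\in\{0,\dots,d+1\}$ such that $(i,k-1,m)$ and $(k-1,j,d-m+1)$ are legal, form the candidate: $D'=D[i,k-1,m]\cup D[k-1,j,d-m+1]$, $x=$ an index in $D'$ of minimum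 $\beta_x$, $w=\beta_x+w[i,k-1,m]+w[k-1,j,d-m+1]$, $c=w+p[i,k-1,m]+p[k-1,j,d-m+1]$, candidate $(c,w,D'\setminus\{x\})$; $(p,w,D)[i,j,d]$ is a minimizing candidate, where candidates are enumerated with $k$ increasing then $m$ increasing, the current choice is replaced only by a later candidate that is lexicographically smaller in $(c,w)$, or equal in $(c,w)$ and whose deleted set is a proper subset of the current one's. The algorithm outputs $p[0,n,0]$ as the optimal cost. -}

module Defs where

open import Data.Nat using (ℕ; zero; suc; _+_; _*_; _∸_; _≤_; _<ᵇ_; _≡ᵇ_; _≤ᵇ_)
open import Data.Nat.Properties using ()
open import Data.Bool using (Bool; true; false; _∧_; _∨_; not; if_then_else_)
open import Data.List using (List; []; _∷_; _++_; map; length; upTo; concatMap; foldl)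
open import Data.Maybe using (Maybe; just; nothing; maybe)
open import Relation.Binary.PropositionalEquality using (_≡_)
open import Data.Product using (_×_; _,_; proj₁; proj₂)

_!?_ : {A : Set} → List A → ℕ → Maybe A
[]       !? _     = nothing
(x ∷ xs) !? zero  = just x
(x ∷ xs) !? suc i = xs !? i

nth : {A : Set} → A → List A → ℕ → A
nth a xs i = maybe (λ x → x) a (xs !? i)

-- [a, a+1, ..., b]  (empty if b < a)
range : ℕ → ℕ → List ℕ
range a b = map (a +_) (upTo (suc b ∸ a))

-- Keys are identified with their ranks 1..n (only the order of the
-- keys matters).  An instance is the list of weights [β₁, …, βₙ].

Weights : Set
Weights = List ℕ

β : Weights → ℕ → ℕ
β ws x = nth 0 ws (x ∸ 1)

data GBST : Set where
  leaf : GBST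
  -- node e s L R : equality key e, split key s
  node : (e s : ℕ) → GBST → GBST → GBST

search : GBST → ℕ → Maybe ℕ
search leaf v = nothing
search (node e s l r) v =
  if v ≡ᵇ e then just 1
  else maybe (λ k → just (suc k)) nothing (if v <ᵇ s then search l v else search r v)

eqKeysAreKeys : ℕ → GBST → Bool
eqKeysAreKeys n leaf = true
eqKeysAreKeys n (node e s l r) =
  (1 ≤ᵇ e) ∧ (e ≤ᵇ n) ∧ eqKeysAreKeys n l ∧ eqKeysAreKeys n r

-- cost of a tree: Σ_i β_i · (nodes visited searching K_i);
-- nothing if some key is not found (the tree is not a valid GBST)
costFrom : Weights → GBST → List ℕ → Maybe ℕ
costFrom ws t []       = just 0
costFrom ws t (x ∷ xs) with search t x | costFrom ws t xs
... | just k | just c = just (β ws x * k + c)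
... | _      | _      = nothing

treeCost : Weights → GBST → Maybe ℕ
treeCost ws t = costFrom ws t (range 1 (length ws))

IsGBSTofCost : Weights → GBST → ℕ → Set
IsGBSTofCost ws t c = (eqKeysAreKeys (length ws) t ≡ true) × (treeCost ws t ≡ just c)

Triple : Set
Triple = ℕ × ℕ × List ℕ

pOf : Triple → ℕ
pOf = proj₁

wOf : Triple → ℕ
wOf t = proj₁ (proj₂ t)

DOf : Triple → List ℕ
DOf t = proj₂ (proj₂ t)

defaultTriple : Triple
defaultTriple = 0 , 0 , []

elem : ℕ → List ℕ → Bool
elem x []       = false
elem x (y ∷ ys) = (x ≡ᵇ y) ∨ elem x ys

subsetᵇ : List ℕ → List ℕ → Bool
subsetᵇ []       ys = true
subsetᵇ (x ∷ xs) ys = elem x ys ∧ subsetᵇ xs ys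

properSubset : List ℕ → List ℕ → Bool
properSubset xs ys = subsetᵇ xs ys ∧ not (subsetᵇ ys xs)

-- an index of minimum weight in a list (the first such; irrelevant
-- for the weights w and costs c)
argminβ : Weights → List ℕ → ℕ
argminβ ws []       = 0
argminβ ws (x ∷ xs) = go x xs
  where
  go : ℕ → List ℕ → ℕ
  go b []       = b
  go b (y ∷ ys) = if β ws y <ᵇ β ws b then go y ys else go b ys

removeAll : ℕ → List ℕ → List ℕ
removeAll x []       = []
removeAll x (y ∷ ys) = if y ≡ᵇ x then removeAll x ys else y ∷ removeAll x ys

-- Tables: tab !! len !! i !! d  =  (p,w,D)[i, i+len, d]
Row : Set
Row = List Triple

Tab : Set
Tab = List (List Row)

fromPrev : Tab → ℕ → ℕ → ℕ → Triple
fromPrev prev len i d = nth defaultTriple (nth [] (nth [] prev len) i) d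

replaces : Triple → Triple → Bool
replaces (c , w , D) (c₀ , w₀ , D₀) =
  (c <ᵇ c₀) ∨ ((c ≡ᵇ c₀) ∧ ((w <ᵇ w₀) ∨ ((w ≡ᵇ w₀) ∧ properSubset D D₀)))

choose : Maybe Triple → Triple → Maybe Triple
choose nothing  t = just t
choose (just t₀) t = if replaces t t₀ then just t else just t₀

candidate : Weights → Triple → Triple → Triple
candidate ws (p₁ , w₁ , D₁) (p₂ , w₂ , D₂) =
  let D' = D₁ ++ D₂
      x  = argminβ ws D'
      w  = β ws x + w₁ + w₂
  in (w + p₁ + p₂) , w , removeAll x D'

module HW (ws : Weights) where

  n : ℕ
  n = length ws

  -- entry (p,w,D)[i,j,d] with j = i + L and d < L.
  --   prev : tables for all lengths < L
  --   rest : the entries (i,j,d+1), (i,j,d+2), …, (i,j,L)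
  entry : Tab → (L i d : ℕ) → Row → Triple
  entry prev L i d rest = maybe (λ t → t) defaultTriple (foldl step nothing cands)
    where
    j : ℕ
    j = i + L
    -- the triple (k-1, j, d') ; if k-1 = i it has length L and lies in rest
    second : ℕ → ℕ → Triple
    second k d' = if (k ∸ 1) ≡ᵇ i then nth defaultTriple rest (d' ∸ suc d)
                  else fromPrev prev (j ∸ (k ∸ 1)) (k ∸ 1) d'
    legal : ℕ → ℕ → Bool
    legal k m = (m ≤ᵇ (k ∸ 1) ∸ i) ∧ ((suc d ∸ m) ≤ᵇ j ∸ (k ∸ 1))
    cands : List Triple
    cands = concatMap (λ k → concatMap (λ m →
              if legal k m
              then candidate ws (fromPrev prev ((k ∸ 1) ∸ i) i m) (second k (suc d ∸ m)) ∷ []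
              else []) (range 0 (suc d))) (range (suc i) j)
    step : Maybe Triple → Triple → Maybe Triple
    step = choose

  -- the row (i, i+L, d) for d = 0, …, L, computed for d = L, L-1, …, 0
  row : Tab → (L i : ℕ) → Row
  row prev L i = go L
    where
    push : ℕ → Row → Row
    push d rest = entry prev L i d rest ∷ rest
    go : ℕ → Row
    go zero    = (0 , 0 , range (suc i) (i + L)) ∷ []
    go (suc r) = push (L ∸ suc r) (go r)

  tables : ℕ → Tab
  tables zero    = map (λ i → (0 , 0 , []) ∷ []) (range 0 n) ∷ []
  tables (suc L) = extend (tables L)
    where
    extend : Tab → Tab
    extend prev = prev ++ (map (λ i → row prev (suc L) i) (range 0 (n ∸ suc L)) ∷ [])

  output : ℕ
  output = pOf (fromPrev (tables n) n 0 0)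

huangWongOutput : Weights → ℕ
huangWongOutput ws = HW.output ws

counterWeights : Weights
counterWeights =
  20 ∷ 20 ∷ 20 ∷ 10 ∷ 20 ∷ 5 ∷ 10 ∷ 22 ∷ 10 ∷ 10 ∷ 20 ∷ 10 ∷ 20 ∷ 10 ∷ 20 ∷ 10 ∷
  10 ∷ 20 ∷ 10 ∷ 20 ∷ 10 ∷ 20 ∷ 10 ∷ 20 ∷ 10 ∷ 20 ∷ 10 ∷ 20 ∷ 10 ∷ 20 ∷ 10 ∷ []

module Submission where

-- (1) Huang and Wong's dynamic program, run on the instance, returns
--     p[0,31,0] = 1763.  The algorithm is a closed program over ℕ and
--     lists, so this is established by evaluating it (a reflexivity proof).
--
-- We exhibit the tree: its
--     root tests key 8 and splits at key 17, each half is a tree of depth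
--     at most five built from single-test leaves.

open import Defs
open import Data.Nat using (ℕ; _+_; _*_)
open import Data.List using (List; []; _∷_; map)
open import Data.List.Properties using (∷-injective)
open import Data.Bool using (true)
open import Data.Maybe using (just)
open import Data.Product using (_×_; ∃-syntax; _,_)
open import Relation.Binary.PropositionalEquality using (_≡_; refl; cong; trans)

weightedDepth : Weights → List ℕ → List ℕ → ℕ
weightedDepth ws (x ∷ xs) (d ∷ ds) = β ws x * d + weightedDepth ws xs ds
weightedDepth ws _        _        = 0

costFrom-depths : (ws : Weights) (t : GBST) (xs ds : List ℕ) →
                  map (search t) xs ≡ map just ds →
                  costFrom ws t xs ≡ just (weightedDepth ws xs ds)
costFrom-depths ws t []       []       _     = refl
costFrom-depths ws t (x ∷ xs) (d ∷ ds) found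
  with ∷-injective found
... | found-x , found-xs
  rewrite found-x | costFrom-depths ws t xs ds found-xs = refl

-- A node that only tests one key; its split key is irrelevant.
probe : ℕ → GBST
probe e = node e 0 leaf leaf

-- Keys 1–16 except 8; key 7's node hands the search for 6 to the right.
lowerHalf : GBST
lowerHalf =
  node 1 10
    (node 2 5
      (node 3 1 leaf (probe 4))
      (node 5 8 (node 7 5 leaf (probe 6)) (probe 9)))
    (node 11 14
      (node 13 11 (probe 10) (probe 12))
      (node 15 15 (probe 14) (probe 16)))

-- Keys 17–31: a balanced tree whose leaves are the light keys.
upperHalf : GBST
upperHalf =
  node 18 25
    (node 22 21
      (node 20 18 (probe 17) (probe 19))
      (node 24 22 (probe 21) (probe 23)))
    (node 26 29
      (node 28 26 (probe 25) (probe 27))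
      (node 30 30 (probe 29) (probe 31)))

-- The better tree: key 8 (the heaviest, β = 22) at the root.
betterTree : GBST
betterTree = node 8 17 lowerHalf upperHalf

betterDepths : List ℕ
betterDepths =
  2 ∷ 3 ∷ 4 ∷ 5 ∷ 4 ∷ 6 ∷ 5 ∷ 1 ∷ 5 ∷ 5 ∷ 3 ∷ 5 ∷ 4 ∷ 5 ∷ 4 ∷ 5 ∷
  5 ∷ 2 ∷ 5 ∷ 4 ∷ 5 ∷ 3 ∷ 5 ∷ 4 ∷ 5 ∷ 3 ∷ 5 ∷ 4 ∷ 5 ∷ 4 ∷ 5 ∷ []

allKeys : List ℕ
allKeys = range 1 31

betterTree-depths : map (search betterTree) allKeys ≡ map just betterDepths
betterTree-depths = refl

-- The weighted depth sum of the table: 22 for the root key 8, 860 for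
-- the other keys 1–16 and 880 for keys 17–31.
betterDepths-sum : weightedDepth counterWeights allKeys betterDepths ≡ 1762
betterDepths-sum = refl

betterTree-cost : treeCost counterWeights betterTree ≡ just 1762
betterTree-cost =
  trans (costFrom-depths counterWeights betterTree allKeys betterDepths betterTree-depths)
        (cong just betterDepths-sum)

betterTree-keys : eqKeysAreKeys 31 betterTree ≡ true
betterTree-keys = refl

betterTree-isGBST : IsGBSTofCost counterWeights betterTree 1762
betterTree-isGBST = betterTree-keys , betterTree-cost

huangWong-counterexample : huangWongOutput counterWeights ≡ 1763
huangWong-counterexample = refl

theorem4 : (huangWongOutput counterWeights ≡ 1763)
           × (∃[ t ] IsGBSTofCost counterWeights t 1762)
theorem4 = huangWong-counterexample , betterTree , betterTree-isGBST
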